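{- Let $S$ be a positive semifield and $X$ a set. For all $A\in\mathcal PX$, \[ \delta_X(\eta^{\mathcal S}_{\mathcal PX}(A))=\Bigl\{\phi\in\mathcal SX\ \Bigm|\ \mathrm{supp}\,\phi\subseteq A,\ \sum_{x\in X}\phi(x)=1\Bigr\}. \]
   Context: $S$ positive: $a+b=0\Rightarrow a=b=0$; semifield: nonzero elements have two-sided inverses. $\mathcal SX$ is the set of $\phi\colon X\to S$ with finite support $\mathrm{supp}\,\phi=\{x\mid\phi(x)\neq0\}$; $\eta^{\mathcal S}_{\mathcal PX}(A)=\Delta_A$, the function $\mathcal PX\to S$ sending $A$ to $1$ and everything else to $0$. With $\ni_X=\{(B,x)\mid x\in B\}$, for $\Phi\in\mathcal S\mathcal PX$: $\delta_X(\Phi)=\{\phi\in\mathcal SX\mid\exists\psi\in\mathcal S(\ni_X).\ \forall B\in\mathcal PX.\ \Phi(B)=\sum_{x\in B}\psi(B,x),\ \forall x.\ \phi(x)=\sum_{B\ni x}\psi(B,x)\}$. -}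

module Defs where

open import Level using (Level; _⊔_; Setω) renaming (suc to lsuc)
open import Algebra.Bundles using (Semiring)
open import Relation.Nullary using (¬_; Dec; yes; no)
open import Data.Product using (Σ; ∃; _×_; _,_; proj₁; proj₂)
open import Data.List using (List; []; _∷_; map; foldr)
open import Data.List.Relation.Unary.Any using (Any; here)
open import Data.List.Relation.Unary.AllPairs using (AllPairs; [])
open import Relation.Unary using (Pred; _∈_; _⊆_)
open import Relation.Binary.PropositionalEquality using (_≡_)

-- Classical logic (the paper reasons classically): every proposition is decidable.
LEM : Setω
LEM = ∀ {p} (P : Set p) → Dec P

record IsPositiveSemifield {c ℓ} (S : Semiring c ℓ) : Set (c ⊔ ℓ) where
  open Semiring S
  field
    positive : ∀ a b → a + b ≈ 0# → (a ≈ 0#) × (b ≈ 0#)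
    inverse  : ∀ a → ¬ (a ≈ 0#) → ∃ λ b → (a * b ≈ 1#) × (b * a ≈ 1#)

_≐_ : ∀ {a} {X : Set a} → Pred X a → Pred X a → Set a
A ≐ B = (A ⊆ B) × (B ⊆ A)

-- The relation ∋_X = {(B,x) | x ∈ B}, as a type, with its equality.
Ni : ∀ {a} (X : Set a) → Set (lsuc a)
Ni {a} X = Σ (Pred X a × X) (λ p → proj₂ p ∈ proj₁ p)

_≈Ni_ : ∀ {a} {X : Set a} → Ni X → Ni X → Set a
((B , x) , _) ≈Ni ((B' , x') , _) = (B ≐ B') × (x ≡ x')

module _ {c ℓ} (S : Semiring c ℓ) where
  open Semiring S renaming (Carrier to K)

  -- 𝒮Y for a type Y with equality _~_ : functions Y → S (respecting _~_)
  -- with finite support, witnessed by a duplicate-free list containing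
  -- every y with fun y ≠ 0.
  record FinSupp {a b} (Y : Set a) (_~_ : Y → Y → Set b) : Set (c ⊔ ℓ ⊔ a ⊔ b) where
    field
      fun         : Y → K
      fun-resp    : ∀ {y y'} → y ~ y' → fun y ≈ fun y'
      supp        : List Y
      supp-unique : AllPairs (λ y y' → ¬ (y ~ y')) supp
      supp-covers : ∀ y → ¬ (fun y ≈ 0#) → Any (y ~_) supp
  open FinSupp public

  sumL : List K → K
  sumL = foldr _+_ 0#

  total : ∀ {a b} {Y : Set a} {_~_ : Y → Y → Set b} → FinSupp Y _~_ → K
  total φ = sumL (map (fun φ) (supp φ))

  sumWhere : LEM → ∀ {a p} {E : Set a} → (E → Set p) → (E → K) → List E → K
  sumWhere lem P f [] = 0#
  sumWhere lem P f (e ∷ es) with lem (P e)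
  ... | yes _ = f e + sumWhere lem P f es
  ... | no  _ = sumWhere lem P f es

  Supp : ∀ {a b} {Y : Set a} {_~_ : Y → Y → Set b} → FinSupp Y _~_ → Pred Y ℓ
  Supp φ y = ¬ (fun φ y ≈ 0#)

  module _ (lem : LEM) {a} (X : Set a) where

    𝒮X : Set (c ⊔ ℓ ⊔ a)
    𝒮X = FinSupp X _≡_

    𝒮PX : Set (c ⊔ ℓ ⊔ lsuc a)
    𝒮PX = FinSupp (Pred X a) _≐_

    𝒮Ni : Set (c ⊔ ℓ ⊔ lsuc a)
    𝒮Ni = FinSupp (Ni X) _≈Ni_

    private
      ≐-refl : ∀ {A : Pred X a} → A ≐ A
      ≐-refl = (λ z → z) , (λ z → z)
      ≐-sym : ∀ {A B : Pred X a} → A ≐ B → B ≐ A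
      ≐-sym (p , q) = q , p
      ≐-trans : ∀ {A B C : Pred X a} → A ≐ B → B ≐ C → A ≐ C
      ≐-trans (p , q) (p' , q') = (λ z → p' (p z)) , (λ z → q (q' z))

      Δfun : Pred X a → Pred X a → K
      Δfun A B with lem (B ≐ A)
      ... | yes _ = 1#
      ... | no  _ = 0#

      Δresp : ∀ A {B B'} → B ≐ B' → Δfun A B ≈ Δfun A B'
      Δresp A {B} {B'} e with lem (B ≐ A) | lem (B' ≐ A)
      ... | yes _ | yes _ = refl
      ... | no  _ | no  _ = refl
      ... | yes p | no ¬q = Data.Empty.⊥-elim (¬q (≐-trans (≐-sym e) p))
        where import Data.Empty
      ... | no ¬p | yes q = Data.Empty.⊥-elim (¬p (≐-trans e q))
        where import Data.Empty

      Δcovers : ∀ A B → ¬ (Δfun A B ≈ 0#) → Any (B ≐_) (A ∷ [])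
      Δcovers A B nz with lem (B ≐ A)
      ... | yes p = here p
      ... | no  _ = Data.Empty.⊥-elim (nz refl)
        where import Data.Empty

    -- η^𝒮_{𝒫X}(A) = Δ_A : B ↦ 1 if B = A, 0 otherwise.
    Δ : Pred X a → 𝒮PX
    Δ A = record
      { fun = Δfun A
      ; fun-resp = Δresp A
      ; supp = A ∷ []
      ; supp-unique = Data.List.Relation.Unary.AllPairs._∷_ Data.List.Relation.Unary.All.[] []
      ; supp-covers = Δcovers A
      }
      where import Data.List.Relation.Unary.All

    δ : 𝒮PX → Pred 𝒮X (c ⊔ ℓ ⊔ lsuc a)
    δ Φ φ = Σ 𝒮Ni λ ψ →
        (∀ (B : Pred X a) →
           fun Φ B ≈ sumWhere lem (λ e → proj₁ (proj₁ e) ≐ B) (fun ψ) (supp ψ))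
      × (∀ (x : X) →
           fun φ x ≈ sumWhere lem (λ e → proj₂ (proj₁ e) ≡ x) (fun ψ) (supp ψ))

{-# OPTIONS --safe #-}
-- A decomposition ψ of Δ_A over ∋_X is a family of weights on the pairs (B, x)
-- whose marginal on 𝒫X is Δ_A and whose marginal on X is φ.  By positivity every
-- weight on a pair with B ≠ A vanishes, so φ(x) ≠ 0 forces x ∈ A, and summing φ
-- is summing ψ, i.e. Δ_A(A) = 1.  Conversely ψ(B, x) = [B = A] φ(x) decomposes
-- Δ_A whenever supp φ ⊆ A and Σ φ = 1.
module Submission where

open import Defs
open import Level using (_⊔_)
open import Algebra.Bundles using (Semiring)
import Algebra.Properties.CommutativeSemigroup as CommutativeSemigroupProperties
open import Data.Empty using (⊥-elim)
open import Data.List using (List; []; _∷_; map)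
open import Data.List.Membership.Propositional using (_∈_)
open import Data.List.Relation.Unary.All as All using (All; []; _∷_)
open import Data.List.Relation.Unary.Any using (Any; here; there)
open import Data.List.Relation.Unary.AllPairs using (AllPairs; []; _∷_)
open import Data.Product using (_×_; _,_; proj₁; proj₂)
open import Function.Base using (id)
open import Function.Bundles using (_⇔_; mk⇔)
open import Relation.Binary.PropositionalEquality as ≡ using (_≡_)
import Relation.Binary.Reasoning.Setoid as SetoidReasoning
open import Relation.Nullary using (¬_; Dec; yes; no)
open import Relation.Unary using (Pred; _⊆_)
open import Relation.Unary.Properties using (≐-refl; ≐-sym; ≐-trans)

IsPositive : ∀ {c ℓ} → Semiring c ℓ → Set (c ⊔ ℓ)
IsPositive S = ∀ u v → u + v ≈ 0# → (u ≈ 0#) × (v ≈ 0#)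
  where open Semiring S

setOf : ∀ {a} {X : Set a} → Ni X → Pred X a
setOf e = proj₁ (proj₁ e)

pointOf : ∀ {a} {X : Set a} → Ni X → X
pointOf e = proj₂ (proj₁ e)

module Sums {c ℓ} (S : Semiring c ℓ) (lem : LEM) where
  open Semiring S renaming (Carrier to K)

  ∑ : ∀ {a} {E : Set a} → List E → (E → K) → K
  ∑ l f = sumL S (map f l)

  syntax ∑ l (λ e → t) = ∑[ e ∈ l ] t

  when : ∀ {p} → Set p → K → K
  when Q k with lem Q
  ... | yes _ = k
  ... | no  _ = 0#

  module _ {p} {Q : Set p} {k : K} where

    when-vanishes : (Q → k ≈ 0#) → when Q k ≈ 0#
    when-vanishes k≈0 with lem Q
    ... | yes q = k≈0 q
    ... | no  _ = refl

    when-redundant : (¬ Q → k ≈ 0#) → when Q k ≈ k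
    when-redundant k≈0 with lem Q
    ... | yes _ = refl
    ... | no ¬q = sym (k≈0 ¬q)

    when-true : Q → when Q k ≈ k
    when-true q = when-redundant (λ ¬q → ⊥-elim (¬q q))

    when-false : ¬ Q → when Q k ≈ 0#
    when-false ¬q = when-vanishes (λ q → ⊥-elim (¬q q))

    when-nonzero : ¬ when Q k ≈ 0# → Q × ¬ k ≈ 0#
    when-nonzero nz with lem Q
    ... | yes q = q , nz
    ... | no ¬q = ⊥-elim (nz refl)

  when-cong : ∀ {p q} {Q : Set p} {Q′ : Set q} {k k′} →
              (Q → Q′) → (Q′ → Q) → (Q → k ≈ k′) → when Q k ≈ when Q′ k′
  when-cong {Q = Q} {Q′} to from k≈k′ with lem Q | lem Q′
  ... | yes q | yes _  = k≈k′ q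
  ... | no  _ | no  _  = refl
  ... | yes q | no ¬q′ = ⊥-elim (¬q′ (to q))
  ... | no ¬q | yes q′ = ⊥-elim (¬q (from q′))

  sumWhere-when : ∀ {a p} {E : Set a} (P : E → Set p) (f : E → K) (l : List E) →
                  sumWhere S lem P f l ≈ ∑[ e ∈ l ] when (P e) (f e)
  sumWhere-when P f [] = refl
  sumWhere-when P f (e ∷ es) with lem (P e)
  ... | yes _ = +-congˡ (sumWhere-when P f es)
  ... | no  _ = trans (sumWhere-when P f es) (sym (+-identityˡ _))

  module _ {a} {E : Set a} where

    ∑-cong : ∀ {f g : E → K} (l : List E) → (∀ e → e ∈ l → f e ≈ g e) → ∑ l f ≈ ∑ l g
    ∑-cong []      f≈g = refl
    ∑-cong (e ∷ l) f≈g = +-cong (f≈g e (here ≡.refl)) (∑-cong l (λ e′ m → f≈g e′ (there m)))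

    ∑-zero : ∀ {f : E → K} (l : List E) → (∀ e → e ∈ l → f e ≈ 0#) → ∑ l f ≈ 0#
    ∑-zero l f≈0 = trans (∑-cong l f≈0) (∑-const-0 l)
      where
      ∑-const-0 : ∀ l → ∑[ e ∈ l ] 0# ≈ 0#
      ∑-const-0 []      = refl
      ∑-const-0 (_ ∷ l) = trans (+-identityˡ _) (∑-const-0 l)

    ∑-+ : ∀ (f g : E → K) (l : List E) → ∑[ e ∈ l ] (f e + g e) ≈ ∑ l f + ∑ l g
    ∑-+ f g []      = sym (+-identityˡ _)
    ∑-+ f g (e ∷ l) = trans (+-congˡ (∑-+ f g l))
      (CommutativeSemigroupProperties.interchange +-commutativeSemigroup (f e) (g e) _ _)

    ∑-when : ∀ {p} {Q : Set p} (f : E → K) (l : List E) →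
             ∑[ e ∈ l ] when Q (f e) ≈ when Q (∑ l f)
    ∑-when {Q = Q} f l = by-cases (lem Q)
      where
      by-cases : Dec Q → ∑[ e ∈ l ] when Q (f e) ≈ when Q (∑ l f)
      by-cases (yes q) = trans (∑-cong l (λ e _ → when-true q)) (sym (when-true q))
      by-cases (no ¬q) = trans (∑-zero l (λ e _ → when-false ¬q)) (sym (when-false ¬q))

    ∑≈0⇒≈0 : IsPositive S → ∀ {f : E → K} (l : List E) → ∑ l f ≈ 0# → ∀ {e} → e ∈ l → f e ≈ 0#
    ∑≈0⇒≈0 positive (_ ∷ l) ∑≈0 (here ≡.refl) = proj₁ (positive _ _ ∑≈0)
    ∑≈0⇒≈0 positive (_ ∷ l) ∑≈0 (there m)     = ∑≈0⇒≈0 positive l (proj₂ (positive _ _ ∑≈0)) m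

    ∑-indicator : ∀ {x : E} {k} (l : List E) → AllPairs (λ y y′ → ¬ y ≡ y′) l →
                  (¬ k ≈ 0# → x ∈ l) → ∑[ y ∈ l ] when (x ≡ y) k ≈ k
    ∑-indicator {x} {k} l unique k≉0⇒x∈l with lem (k ≈ 0#)
    ... | yes k≈0 = trans (∑-zero l (λ _ _ → when-vanishes (λ _ → k≈0))) (sym k≈0)
    ... | no  k≉0 = go l unique (k≉0⇒x∈l k≉0)
      where
      go : ∀ l → AllPairs (λ y y′ → ¬ y ≡ y′) l → x ∈ l → ∑[ y ∈ l ] when (x ≡ y) k ≈ k
      go (_ ∷ l) (distinct ∷ _) (here ≡.refl) =
        trans (+-cong (when-true ≡.refl) (∑-zero l (λ y y∈l → when-false (All.lookup distinct y∈l))))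
              (+-identityʳ _)
      go (y ∷ l) (distinct ∷ unique) (there x∈l) =
        trans (+-cong (when-false (λ { ≡.refl → All.lookup distinct x∈l ≡.refl }))
                      (go l unique x∈l))
              (+-identityˡ _)

  sumWhere≈0⇒≈0 : IsPositive S → ∀ {a p} {E : Set a} {P : E → Set p} {f : E → K} (l : List E) →
                  sumWhere S lem P f l ≈ 0# → ∀ {e} → e ∈ l → P e → f e ≈ 0#
  sumWhere≈0⇒≈0 positive {P = P} {f} l sum≈0 e∈l Pe =
    trans (sym (when-true Pe)) (∑≈0⇒≈0 positive l (trans (sym (sumWhere-when P f l)) sum≈0) e∈l)

  ∑-comm : ∀ {a b} {M : Set a} {E : Set b} (h : M → E → K) (ms : List M) (es : List E) →
           ∑[ m ∈ ms ] ∑[ e ∈ es ] h m e ≈ ∑[ e ∈ es ] ∑[ m ∈ ms ] h m e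
  ∑-comm h []       es = sym (∑-zero es (λ _ _ → refl))
  ∑-comm h (m ∷ ms) es = trans (+-congˡ (∑-comm h ms es)) (sym (∑-+ (h m) _ es))

  module _ {a} (X : Set a) where

    Δ-when : ∀ A B → fun (Δ S lem X A) B ≈ when (B ≐ A) 1#
    Δ-when A B with lem (B ≐ A)
    ... | yes _ = refl
    ... | no  _ = refl

    ∑-point : (φ : 𝒮X S lem X) (x : X) → ∑[ y ∈ supp φ ] when (x ≡ y) (fun φ x) ≈ fun φ x
    ∑-point φ x = ∑-indicator (supp φ) (supp-unique φ) (supp-covers φ x)

module Forward {c ℓ a} (S : Semiring c ℓ) (positive : IsPositive S) (lem : LEM)
               (X : Set a) (A : Pred X a) (φ : 𝒮X S lem X)
               (decomposition : δ S lem X (Δ S lem X A) φ) where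
  open Semiring S
  open Sums S lem
  open SetoidReasoning setoid

  ψ : 𝒮Ni S lem X
  ψ = proj₁ decomposition

  Δ-marginal : ∀ B → fun (Δ S lem X A) B ≈ sumWhere S lem (λ e → setOf e ≐ B) (fun ψ) (supp ψ)
  Δ-marginal = proj₁ (proj₂ decomposition)

  φ-marginal : ∀ x → fun φ x ≈ sumWhere S lem (λ e → pointOf e ≡ x) (fun ψ) (supp ψ)
  φ-marginal = proj₂ (proj₂ decomposition)

  vanishes-off-A : ∀ {e} → e ∈ supp ψ → ¬ setOf e ≐ A → fun ψ e ≈ 0#
  vanishes-off-A {e} e∈ψ B≉A = sumWhere≈0⇒≈0 positive (supp ψ)
    (trans (sym (Δ-marginal (setOf e))) (trans (Δ-when X A _) (when-false B≉A)))
    e∈ψ ≐-refl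

  vanishes-off-φ : ∀ {e} → e ∈ supp ψ → fun φ (pointOf e) ≈ 0# → fun ψ e ≈ 0#
  vanishes-off-φ {e} e∈ψ φ≈0 =
    sumWhere≈0⇒≈0 positive (supp ψ) (trans (sym (φ-marginal (pointOf e))) φ≈0) e∈ψ ≡.refl

  supp⊆A : Supp S φ ⊆ A
  supp⊆A {x} φx≉0 with lem (A x)
  ... | yes x∈A = x∈A
  ... | no  x∉A = ⊥-elim (φx≉0 (trans (φ-marginal x)
                    (trans (sumWhere-when _ (fun ψ) (supp ψ)) (∑-zero (supp ψ) summand≈0))))
    where
    summand≈0 : ∀ e → e ∈ supp ψ → when (pointOf e ≡ x) (fun ψ e) ≈ 0#
    summand≈0 e e∈ψ = when-vanishes λ { ≡.refl →
      vanishes-off-A e∈ψ (λ B≐A → x∉A (proj₁ B≐A (proj₂ e))) }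

  total≈1 : total S φ ≈ 1#
  total≈1 = begin
    ∑[ x ∈ supp φ ] fun φ x
      ≈⟨ ∑-cong (supp φ) (λ x _ → trans (φ-marginal x) (sumWhere-when _ (fun ψ) (supp ψ))) ⟩
    ∑[ x ∈ supp φ ] ∑[ e ∈ supp ψ ] when (pointOf e ≡ x) (fun ψ e)
      ≈⟨ ∑-comm (λ x e → when (pointOf e ≡ x) (fun ψ e)) (supp φ) (supp ψ) ⟩
    ∑[ e ∈ supp ψ ] ∑[ x ∈ supp φ ] when (pointOf e ≡ x) (fun ψ e)
      ≈⟨ ∑-cong (supp ψ) (λ e e∈ψ → ∑-indicator (supp φ) (supp-unique φ)
           (λ ψe≉0 → supp-covers φ (pointOf e) (λ φ≈0 → ψe≉0 (vanishes-off-φ e∈ψ φ≈0)))) ⟩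
    ∑[ e ∈ supp ψ ] fun ψ e
      ≈⟨ ∑-cong (supp ψ) (λ e e∈ψ → sym (when-redundant (vanishes-off-A e∈ψ))) ⟩
    ∑[ e ∈ supp ψ ] when (setOf e ≐ A) (fun ψ e)
      ≈⟨ sym (trans (Δ-marginal A) (sumWhere-when _ (fun ψ) (supp ψ))) ⟩
    fun (Δ S lem X A) A
      ≈⟨ trans (Δ-when X A A) (when-true ≐-refl) ⟩
    1# ∎

  conditions : (Supp S φ ⊆ A) × (total S φ ≈ 1#)
  conditions = supp⊆A , total≈1

module Pairs {c ℓ a} (S : Semiring c ℓ) (lem : LEM) (X : Set a) (A : Pred X a) where
  open Semiring S
  open Sums S lem

  pairsWith : List X → List (Ni X)
  pairsWith [] = []
  pairsWith (x ∷ xs) with lem (A x)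
  ... | yes x∈A = ((A , x) , x∈A) ∷ pairsWith xs
  ... | no  _   = pairsWith xs

  pairsWith-All : ∀ {p} {Q : Ni X → Set p} xs →
                  All (λ x → ∀ x∈A → Q ((A , x) , x∈A)) xs → All Q (pairsWith xs)
  pairsWith-All []       []         = []
  pairsWith-All (x ∷ xs) (Qx ∷ Qxs) with lem (A x)
  ... | yes x∈A = Qx x∈A ∷ pairsWith-All xs Qxs
  ... | no  _   = pairsWith-All xs Qxs

  pairsWith-unique : ∀ xs → AllPairs (λ x y → ¬ x ≡ y) xs →
                     AllPairs (λ e e′ → ¬ e ≈Ni e′) (pairsWith xs)
  pairsWith-unique []       []                    = []
  pairsWith-unique (x ∷ xs) (distinct ∷ unique) with lem (A x)
  ... | yes _ = pairsWith-All xs (All.map (λ x≢y _ e≈e′ → x≢y (proj₂ e≈e′)) distinct)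
                ∷ pairsWith-unique xs unique
  ... | no  _ = pairsWith-unique xs unique

  pairsWith-covers : ∀ e → setOf e ≐ A → ∀ {xs} → pointOf e ∈ xs → Any (e ≈Ni_) (pairsWith xs)
  pairsWith-covers e B≐A {x ∷ xs} (here ≡.refl) with lem (A x)
  ... | yes _   = here (B≐A , ≡.refl)
  ... | no  x∉A = ⊥-elim (x∉A (proj₁ B≐A (proj₂ e)))
  pairsWith-covers e B≐A {x ∷ xs} (there x∈xs) with lem (A x)
  ... | yes _ = there (pairsWith-covers e B≐A x∈xs)
  ... | no  _ = pairsWith-covers e B≐A x∈xs

  ∑-pairsWith : ∀ {g : Ni X → Carrier} {h : X → Carrier} →
                (∀ x x∈A → g ((A , x) , x∈A) ≈ h x) → (∀ x → ¬ A x → h x ≈ 0#) →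
                ∀ xs → ∑ (pairsWith xs) g ≈ ∑ xs h
  ∑-pairsWith g≈h h-off-A [] = refl
  ∑-pairsWith g≈h h-off-A (x ∷ xs) with lem (A x)
  ... | yes x∈A = +-cong (g≈h x x∈A) (∑-pairsWith g≈h h-off-A xs)
  ... | no  x∉A = trans (∑-pairsWith g≈h h-off-A xs)
                        (sym (trans (+-congʳ (h-off-A x x∉A)) (+-identityˡ _)))

module Backward {c ℓ a} (S : Semiring c ℓ) (lem : LEM) (X : Set a) (A : Pred X a)
                (φ : 𝒮X S lem X)
                (conditions : (Supp S φ ⊆ A) × Semiring._≈_ S (total S φ) (Semiring.1# S)) where
  open Semiring S
  open Sums S lem
  open Pairs S lem X A
  open SetoidReasoning setoid

  supp⊆A : Supp S φ ⊆ A
  supp⊆A = proj₁ conditions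

  total≈1 : total S φ ≈ 1#
  total≈1 = proj₂ conditions

  vanishes-off-A : ∀ x → ¬ A x → fun φ x ≈ 0#
  vanishes-off-A x x∉A with lem (fun φ x ≈ 0#)
  ... | yes φx≈0 = φx≈0
  ... | no  φx≉0 = ⊥-elim (x∉A (supp⊆A φx≉0))

  ψ : 𝒮Ni S lem X
  ψ = record
    { fun         = λ e → when (setOf e ≐ A) (fun φ (pointOf e))
    ; fun-resp    = λ { (B≐B′ , ≡.refl) → when-cong (≐-trans (≐-sym B≐B′)) (≐-trans B≐B′) (λ _ → refl) }
    ; supp        = pairsWith (supp φ)
    ; supp-unique = pairsWith-unique (supp φ) (supp-unique φ)
    ; supp-covers = λ e ψe≉0 → let (B≐A , φ≉0) = when-nonzero ψe≉0 in
                      pairsWith-covers e B≐A (supp-covers φ (pointOf e) φ≉0)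
    }

  ∑ψ-when : ∀ {p} (Q : Ni X → Set p) (Q′ : X → Set p) → (∀ x x∈A → Q ((A , x) , x∈A) → Q′ x) →
            (∀ x x∈A → Q′ x → Q ((A , x) , x∈A)) →
            ∑[ e ∈ supp ψ ] when (Q e) (fun ψ e) ≈ ∑[ x ∈ supp φ ] when (Q′ x) (fun φ x)
  ∑ψ-when Q Q′ to from = ∑-pairsWith
    (λ x x∈A → when-cong (to x x∈A) (from x x∈A) (λ _ → when-true ≐-refl))
    (λ x x∉A → when-vanishes (λ _ → vanishes-off-A x x∉A))
    (supp φ)

  Δ-marginal : ∀ B → fun (Δ S lem X A) B ≈ sumWhere S lem (λ e → setOf e ≐ B) (fun ψ) (supp ψ)
  Δ-marginal B = begin
    fun (Δ S lem X A) B
      ≈⟨ Δ-when X A B ⟩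
    when (B ≐ A) 1#
      ≈⟨ when-cong ≐-sym ≐-sym (λ _ → sym total≈1) ⟩
    when (A ≐ B) (total S φ)
      ≈⟨ ∑-when (fun φ) (supp φ) ⟨
    ∑[ x ∈ supp φ ] when (A ≐ B) (fun φ x)
      ≈⟨ ∑ψ-when (λ e → setOf e ≐ B) (λ _ → A ≐ B) (λ _ _ → id) (λ _ _ → id) ⟨
    ∑[ e ∈ supp ψ ] when (setOf e ≐ B) (fun ψ e)
      ≈⟨ sumWhere-when _ (fun ψ) (supp ψ) ⟨
    sumWhere S lem (λ e → setOf e ≐ B) (fun ψ) (supp ψ) ∎

  φ-marginal : ∀ x → fun φ x ≈ sumWhere S lem (λ e → pointOf e ≡ x) (fun ψ) (supp ψ)
  φ-marginal x = begin
    fun φ x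
      ≈⟨ ∑-point X φ x ⟨
    ∑[ y ∈ supp φ ] when (x ≡ y) (fun φ x)
      ≈⟨ ∑-cong (supp φ) (λ y _ → when-cong ≡.sym ≡.sym (λ { ≡.refl → refl })) ⟩
    ∑[ y ∈ supp φ ] when (y ≡ x) (fun φ y)
      ≈⟨ ∑ψ-when (λ e → pointOf e ≡ x) (_≡ x) (λ _ _ → id) (λ _ _ → id) ⟨
    ∑[ e ∈ supp ψ ] when (pointOf e ≡ x) (fun ψ e)
      ≈⟨ sumWhere-when _ (fun ψ) (supp ψ) ⟨
    sumWhere S lem (λ e → pointOf e ≡ x) (fun ψ) (supp ψ) ∎

  decomposition : δ S lem X (Δ S lem X A) φ
  decomposition = ψ , Δ-marginal , φ-marginal

lemma4p3 : ∀ {c ℓ a} (S : Semiring c ℓ) → IsPositiveSemifield S →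
           (lem : LEM) (X : Set a) (A : Pred X a) (φ : 𝒮X S lem X) →
           δ S lem X (Δ S lem X A) φ
             ⇔ ((Supp S φ ⊆ A) × Semiring._≈_ S (total S φ) (Semiring.1# S))
lemma4p3 S semifield lem X A φ = mk⇔
  (Forward.conditions S (IsPositiveSemifield.positive semifield) lem X A φ)
  (Backward.decomposition S lem X A φ)
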